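{- Let $A=(A,a_0,a_1)$ and $B=(B,b_0,b_1)$ be bipointed types and $(f,\bar f_0,\bar f_1):A\to B$ a bipointed morphism. Then $(f,\bar f_0,\bar f_1)$ is a bipointed equivalence if and only if $f:A\to B$ is an equivalence; in fact the canonical function $\pi_f:\mathsf{isbipequiv}(f,\bar f_0,\bar f_1)\to\mathsf{isequiv}(f)$ (forgetting the bipointed structure of the inverses and of the paths, then using the equivalence between $\mathsf{isequiv}(f)$ and the type of pairs of a left and a right inverse) is an equivalence of types.
   Context: Work in the intensional Martin-Löf type theory $\mathcal{H}$ with $\Sigma$-types, $\Pi$-types (with judgemental $\eta$), identity types, a universe $\mathsf{U}$, and function extensionality; no UIP. $\mathsf{iscontr}(X):=(\Sigma x:X)(\Pi y:X)\mathsf{Id}(x,y)$; $\mathsf{hfiber}(f,y):=(\Sigma x)\mathsf{Id}(fx,y)$; $\mathsf{isequiv}(f):=(\Pi y)\mathsf{iscontr}(\mathsf{hfiber}(f,y))$, which is known to be equivalent to $(\Sigma g:B\to A)\mathsf{Id}(gf,1_A)\times(\Sigma h:B\to A)\mathsf{Id}(fh,1_B)$. A bipointed type is $(A,a_0,a_1)$ with $a_0,a_1:A$. A bipointed morphism $(A,a_0,a_1)\to(B,b_0,b_1)$ is $(f,\bar f_0,\bar f_1)$ with $f:A\to B$, $\bar f_k:\mathsf{Id}(fa_k,b_k)$; $\mathsf{Bip}(A,B)$ is their type. Composite of $(f,\bar f_0,\bar f_1)$ and $(g,\bar g_0,\bar g_1)$ is $(g\circ f,\bar g_0\cdot(g\circ\bar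 f_0),\bar g_1\cdot(g\circ\bar f_1))$ ($g\circ p$ the action of $g$ on paths, $q\cdot p$ means $p$ then $q$); identity is $(1_A,\mathsf{refl}(a_0),\mathsf{refl}(a_1))$. $\mathsf{isbipequiv}(f):=(\Sigma g:\mathsf{Bip}(B,A))\mathsf{Id}_{\mathsf{Bip}(A,A)}(gf,1_A)\times(\Sigma h:\mathsf{Bip}(B,A))\mathsf{Id}_{\mathsf{Bip}(B,B)}(fh,1_B)$; $f$ is a bipointed equivalence if this type is inhabited. -}

module Defs where

open import Level using (0ℓ)
open import Data.Product using (Σ; _×_; _,_; proj₁; proj₂)
open import Function using (_∘_; id)
open import Function.Bundles using (mk↔ₛ′)
open import Function.Properties.Inverse.HalfAdjointEquivalence using (_≃_; ↔⇒≃)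
open import Relation.Binary.PropositionalEquality
  using (_≡_; refl; sym; trans; cong; cong-app)
open import Axiom.Extensionality.Propositional using (Extensionality)

FunExt : Set₁
FunExt = Extensionality 0ℓ 0ℓ

iscontr : Set → Set
iscontr X = Σ X (λ x → (y : X) → x ≡ y)

hfiber : {A B : Set} → (A → B) → B → Set
hfiber {A} f y = Σ A (λ x → f x ≡ y)

isequiv : {A B : Set} → (A → B) → Set
isequiv {A} {B} f = (y : B) → iscontr (hfiber f y)

biinv : {A B : Set} → (A → B) → Set
biinv {A} {B} f =
  Σ (B → A) (λ g → g ∘ f ≡ id) × Σ (B → A) (λ h → f ∘ h ≡ id)

private
  fib-lemma : {A B : Set} (f : A → B) {a b : A} (q : a ≡ b)
              (r : f a ≡ f b) → cong f q ≡ r →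
              _≡_ {A = hfiber f (f b)} (a , r) (b , refl)
  fib-lemma f refl .refl refl = refl

  hae→isequiv : {A B : Set} (e : A ≃ B) → isequiv (_≃_.to e)
  hae→isequiv {A} {B} e y = (from y , right-inverse-of y) , contr y
    where
    open _≃_ e
    contr : (z : B) (w : hfiber to z) → (from z , right-inverse-of z) ≡ w
    contr .(to x) (x , refl) =
      fib-lemma to (left-inverse-of x) (right-inverse-of (to x))
                (left-right x)

biinv→isequiv : {A B : Set} (f : A → B) → biinv f → isequiv f
biinv→isequiv {A} {B} f ((g , gf) , (h , fh)) =
  hae→isequiv (↔⇒≃ (mk↔ₛ′ f h ε η'))
  where
  η : (x : A) → g (f x) ≡ x
  η = cong-app gf
  ε : (y : B) → f (h y) ≡ y
  ε = cong-app fh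
  η' : (x : A) → h (f x) ≡ x
  η' x = trans (sym (η (h (f x)))) (trans (cong g (ε (f x))) (η x))

record BipType : Set₁ where
  constructor bip
  field
    Carrier : Set
    pt₀ : Carrier
    pt₁ : Carrier
open BipType public

Bip : BipType → BipType → Set
Bip A B = Σ (Carrier A → Carrier B)
            (λ f → (f (pt₀ A) ≡ pt₀ B) × (f (pt₁ A) ≡ pt₁ B))

-- composite g ∘ f of bipointed morphisms:
-- (g∘f , ḡ₀ · (g∘f̄₀) , ḡ₁ · (g∘f̄₁)), where q · p means p then q
_∘b_ : {A B C : BipType} → Bip B C → Bip A B → Bip A C
(g , g₀ , g₁) ∘b (f , f₀ , f₁) =
  (g ∘ f) , trans (cong g f₀) g₀ , trans (cong g f₁) g₁

idb : (A : BipType) → Bip A A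
idb A = id , refl , refl

isbipequiv : {A B : BipType} → Bip A B → Set
isbipequiv {A} {B} f =
  Σ (Bip B A) (λ g → g ∘b f ≡ idb A) × Σ (Bip B A) (λ h → f ∘b h ≡ idb B)

π : {A B : BipType} (f : Bip A B) → isbipequiv f → isequiv (proj₁ f)
π f ((g , p) , (h , q)) =
  biinv→isequiv (proj₁ f) ((proj₁ g , cong proj₁ p) , (proj₁ h , cong proj₁ q))

_⇔_ : Set → Set → Set
X ⇔ Y = (X → Y) × (Y → X)

module Submission where

-- If f is an equivalence then both isbipequiv f and isequiv f are contractible.
-- A bipointed left inverse of f amounts to a left inverse g with a homotopy
-- H : g ∘ f ≡ id (a point in a fibre of the equivalence k ↦ k ∘ f) together
-- with, at each base point, a factorisation of H through ḡₖ, which is unique by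
-- path induction; dually for right inverses, using k ↦ f ∘ k and the fibres of f.
-- As isequiv f is a proposition, every fibre of π is then a fibre of a map
-- between contractible types.

open import Defs
open import Data.Product using (Σ; _×_; _,_; proj₁; proj₂)
open import Function using (_∘_; id)
open import Relation.Binary.PropositionalEquality
  using (_≡_; refl; sym; trans; cong; cong-app)
open import Relation.Binary.PropositionalEquality.Properties using (trans-symˡ)

iscontr⇒≡ : {X : Set} → iscontr X → (x y : X) → x ≡ y
iscontr⇒≡ (c , k) x y = trans (sym (k x)) (k y)

iscontr-≡ : {X : Set} → iscontr X → (x y : X) → iscontr (x ≡ y)
iscontr-≡ {X} (c , k) x y = iscontr⇒≡ (c , k) x y , centre≡
  where
  centre≡ : {y : X} (p : x ≡ y) → trans (sym (k x)) (k y) ≡ p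
  centre≡ refl = trans-symˡ (k x)

iscontr-isProp : FunExt → {X : Set} (u v : iscontr X) → u ≡ v
iscontr-isProp ext {X} (c , k) (c' , k') = go (k c') k'
  where
  go : {c' : X} (p : c ≡ c') (k' : (y : X) → c' ≡ y) → (c , k) ≡ (c' , k')
  go refl k' = cong (c ,_) (ext λ y → iscontr⇒≡ (iscontr-≡ (c , k) c y) (k y) (k' y))

Σ-iscontr : {X : Set} {F : X → Set} →
  iscontr X → ((x : X) → iscontr (F x)) → iscontr (Σ X F)
Σ-iscontr {X} {F} (c , k) cF = (c , proj₁ (cF c)) , λ (x , y) → go (k x) y
  where
  go : {x : X} (p : c ≡ x) (y : F x) → _≡_ {A = Σ X F} (c , proj₁ (cF c)) (x , y)
  go refl y = cong (c ,_) (proj₂ (cF c) y)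

×-iscontr : {X Y : Set} → iscontr X → iscontr Y → iscontr (X × Y)
×-iscontr cX cY = Σ-iscontr cX (λ _ → cY)

retract-iscontr : {X Y : Set} (s : Y → X) (r : X → Y) →
  ((y : Y) → r (s y) ≡ y) → iscontr X → iscontr Y
retract-iscontr s r rs (c , k) =
  r c , λ y → trans (cong r (iscontr⇒≡ (c , k) c (s y))) (rs y)

singleton-iscontr : {X : Set} {x : X} → iscontr (Σ X (λ y → x ≡ y))
singleton-iscontr {X} {x} = (x , refl) , λ { (y , refl) → refl }

trans-factorisations-iscontr : {X : Set} {x y z : X} (p : x ≡ y) (c : x ≡ z) →
  iscontr (Σ (y ≡ z) (λ q → c ≡ trans p q))
trans-factorisations-iscontr refl c = singleton-iscontr

iscontr⇒isequiv : {X Y : Set} → iscontr X → iscontr Y → (g : X → Y) → isequiv g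
iscontr⇒isequiv cX cY g y = Σ-iscontr cX (λ x → iscontr-≡ cY (g x) y)

isequiv-iscontr : FunExt → {A B : Set} {f : A → B} → isequiv f → iscontr (isequiv f)
isequiv-iscontr ext e = e , λ e' → ext λ y → iscontr-isProp ext (e y) (e' y)

module _ {A B : Set} {f : A → B} (e : isequiv f) where

  isequiv-inv : B → A
  isequiv-inv y = proj₁ (proj₁ (e y))

  isequiv-ε : (y : B) → f (isequiv-inv y) ≡ y
  isequiv-ε y = proj₂ (proj₁ (e y))

  isequiv-η : (x : A) → isequiv-inv (f x) ≡ x
  isequiv-η x = cong proj₁ (proj₂ (e (f x)) (x , refl))

  isequiv-precomp : FunExt → {C : Set} → isequiv (λ (k : B → C) → k ∘ f)
  isequiv-precomp ext = biinv→isequiv _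
    ( ((_∘ isequiv-inv) , ext λ k → ext λ y → cong k (isequiv-ε y))
    , ((_∘ isequiv-inv) , ext λ k → ext λ x → cong k (isequiv-η x)))

  isequiv-postcomp : FunExt → {C : Set} → isequiv (λ (k : C → A) → f ∘ k)
  isequiv-postcomp ext = biinv→isequiv _
    ( ((isequiv-inv ∘_) , ext λ k → ext λ z → isequiv-η (k z))
    , ((isequiv-inv ∘_) , ext λ k → ext λ z → isequiv-ε (k z)))

module _ {A B : Set} (f : A → B) {b : B} {x x' : A} {u : f x ≡ b} {u' : f x' ≡ b} where

  hfiber-≡ : (q : x ≡ x') → u ≡ trans (cong f q) u' →
    _≡_ {A = hfiber f b} (x , u) (x' , u')
  hfiber-≡ refl refl = refl

  ≡-hfiber : _≡_ {A = hfiber f b} (x , u) (x' , u') →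
    Σ (x ≡ x') (λ q → u ≡ trans (cong f q) u')
  ≡-hfiber refl = refl , refl

  ≡-hfiber∘hfiber-≡ : (q : x ≡ x') (c : u ≡ trans (cong f q) u') →
    ≡-hfiber (hfiber-≡ q c) ≡ (q , c)
  ≡-hfiber∘hfiber-≡ refl refl = refl

  hfiber-≡-iscontr : isequiv f → iscontr (Σ (x ≡ x') (λ q → u ≡ trans (cong f q) u'))
  hfiber-≡-iscontr e = retract-iscontr (λ (q , c) → hfiber-≡ q c) ≡-hfiber
    (λ (q , c) → ≡-hfiber∘hfiber-≡ q c) (iscontr-≡ (e b) _ _)

module _ {X : BipType} {k : Carrier X → Carrier X}
         {p₀ : k (pt₀ X) ≡ pt₀ X} {p₁ : k (pt₁ X) ≡ pt₁ X} where

  ≡idb : (H : k ≡ id) → cong-app H (pt₀ X) ≡ p₀ → cong-app H (pt₁ X) ≡ p₁ →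
    (k , p₀ , p₁) ≡ idb X
  ≡idb refl refl refl = refl

  ≡idb-pt₀ : (P : (k , p₀ , p₁) ≡ idb X) → cong-app (cong proj₁ P) (pt₀ X) ≡ p₀
  ≡idb-pt₀ refl = refl

  ≡idb-pt₁ : (P : (k , p₀ , p₁) ≡ idb X) → cong-app (cong proj₁ P) (pt₁ X) ≡ p₁
  ≡idb-pt₁ refl = refl

  ≡idb-η : (P : (k , p₀ , p₁) ≡ idb X) → ≡idb (cong proj₁ P) (≡idb-pt₀ P) (≡idb-pt₁ P) ≡ P
  ≡idb-η refl = refl

module _ {A B : BipType} (f : Carrier A → Carrier B)
         (f₀ : f (pt₀ A) ≡ pt₀ B) (f₁ : f (pt₁ A) ≡ pt₁ B) where

  BipLeftInverse BipRightInverse : Set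
  BipLeftInverse = Σ (Bip B A) (λ g → g ∘b (f , f₀ , f₁) ≡ idb A)
  BipRightInverse = Σ (Bip B A) (λ h → (f , f₀ , f₁) ∘b h ≡ idb B)

  module _ (ext : FunExt) (e : isequiv f) where

    bip-left-inverses-iscontr : iscontr BipLeftInverse
    bip-left-inverses-iscontr = retract-iscontr split assemble assemble∘split
      (Σ-iscontr (isequiv-precomp e ext id) λ (g , H) →
        ×-iscontr (trans-factorisations-iscontr (cong g f₀) (cong-app H (pt₀ A)))
                  (trans-factorisations-iscontr (cong g f₁) (cong-app H (pt₁ A))))
      where
      Data : Set
      Data = Σ (hfiber (λ (k : Carrier B → Carrier A) → k ∘ f) id) λ (g , H) →
          Σ (g (pt₀ B) ≡ pt₀ A) (λ g₀ → cong-app H (pt₀ A) ≡ trans (cong g f₀) g₀)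
        × Σ (g (pt₁ B) ≡ pt₁ A) (λ g₁ → cong-app H (pt₁ A) ≡ trans (cong g f₁) g₁)

      split : BipLeftInverse → Data
      split ((g , g₀ , g₁) , P) = (g , cong proj₁ P) , (g₀ , ≡idb-pt₀ P) , (g₁ , ≡idb-pt₁ P)

      assemble : Data → BipLeftInverse
      assemble ((g , H) , (g₀ , c₀) , (g₁ , c₁)) = (g , g₀ , g₁) , ≡idb H c₀ c₁

      assemble∘split : (l : BipLeftInverse) → assemble (split l) ≡ l
      assemble∘split (g , P) = cong (g ,_) (≡idb-η P)

    bip-right-inverses-iscontr : iscontr BipRightInverse
    bip-right-inverses-iscontr = retract-iscontr split assemble assemble∘split
      (Σ-iscontr (isequiv-postcomp e ext id) λ (h , H) →
        ×-iscontr (hfiber-≡-iscontr f e) (hfiber-≡-iscontr f e))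
      where
      Data : Set
      Data = Σ (hfiber (λ (k : Carrier B → Carrier A) → f ∘ k) id) λ (h , H) →
          Σ (h (pt₀ B) ≡ pt₀ A) (λ h₀ → cong-app H (pt₀ B) ≡ trans (cong f h₀) f₀)
        × Σ (h (pt₁ B) ≡ pt₁ A) (λ h₁ → cong-app H (pt₁ B) ≡ trans (cong f h₁) f₁)

      split : BipRightInverse → Data
      split ((h , h₀ , h₁) , P) = (h , cong proj₁ P) , (h₀ , ≡idb-pt₀ P) , (h₁ , ≡idb-pt₁ P)

      assemble : Data → BipRightInverse
      assemble ((h , H) , (h₀ , c₀) , (h₁ , c₁)) = (h , h₀ , h₁) , ≡idb H c₀ c₁

      assemble∘split : (r : BipRightInverse) → assemble (split r) ≡ r
      assemble∘split (h , P) = cong (h ,_) (≡idb-η P)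

isbipequiv-iscontr : FunExt → {A B : BipType} (F : Bip A B) →
  isequiv (proj₁ F) → iscontr (isbipequiv F)
isbipequiv-iscontr ext (f , f₀ , f₁) e =
  ×-iscontr (bip-left-inverses-iscontr f f₀ f₁ ext e)
            (bip-right-inverses-iscontr f f₀ f₁ ext e)

proposition2p12 : FunExt → (A B : BipType) (f : Bip A B) →
    (isbipequiv f ⇔ isequiv (proj₁ f)) × isequiv (π f)
proposition2p12 ext A B F =
  (π F , proj₁ ∘ isbipequiv-iscontr ext F)
  , λ e → iscontr⇒isequiv (isbipequiv-iscontr ext F e) (isequiv-iscontr ext e) (π F) e
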